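{- Let $G$ be a connected finite simple graph with $|V(G)|\ge 3$. Then $\det(G)\le 2\det'(G)$.
   Context: A vertex set $S$ is a vertex determining set if the only automorphism of $G$ fixing every vertex of $S$ is the identity; $\det(G)$ is the minimum size of such a set. For a graph with at most one isolated vertex and no $K_2$ component, an edge set $T$ is an edge determining set if the only automorphism $\phi$ with $\{\phi(u),\phi(v)\}=\{u,v\}$ for all $\{u,v\}\in T$ is the identity; $\det'(G)$ is the minimum size of such a set. -}

module Defs where

open import Data.Nat using (ℕ; _≤_; _<_; _*_)
open import Data.Fin using (Fin)
import Data.Fin as F
open import Data.Fin.Subset using (Subset; _∈_; ∣_∣)
open import Data.Bool using (Bool; true; false)
open import Data.List using (List; length)
open import Data.List.Relation.Unary.All using (All)
open import Data.List.Relation.Unary.Unique.Propositional using (Unique)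
open import Data.Product using (_×_; _,_; Σ; ∃)
open import Data.Sum using (_⊎_)
open import Relation.Binary.PropositionalEquality using (_≡_)

record Graph (n : ℕ) : Set where
  field
    adj   : Fin n → Fin n → Bool
    sym   : ∀ u v → adj u v ≡ adj v u
    irrefl : ∀ u → adj u u ≡ false
open Graph public

module _ {n : ℕ} (G : Graph n) where

  data Walk : Fin n → Fin n → Set where
    here : ∀ {u} → Walk u u
    step : ∀ {u v w} → adj G u v ≡ true → Walk v w → Walk u w

  Connected : Set
  Connected = ∀ u v → Walk u v

  record Automorphism : Set where
    field
      fun     : Fin n → Fin n
      inv     : Fin n → Fin n
      left    : ∀ u → inv (fun u) ≡ u
      right   : ∀ u → fun (inv u) ≡ u
      preserve : ∀ u v → adj G (fun u) (fun v) ≡ adj G u v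
  open Automorphism public

  IsIdentity : Automorphism → Set
  IsIdentity φ = ∀ u → fun φ u ≡ u

  IsVertexDetermining : Subset n → Set
  IsVertexDetermining S =
    (φ : Automorphism) → (∀ u → u ∈ S → fun φ u ≡ u) → IsIdentity φ

  IsDet : ℕ → Set
  IsDet d = (Σ (Subset n) λ S → IsVertexDetermining S × ∣ S ∣ ≡ d)
          × (∀ S → IsVertexDetermining S → d ≤ ∣ S ∣)

  -- edge sets: duplicate-free lists of pairs (u , v) with u < v and u ~ v,
  -- each pair representing the edge {u , v}; size = length
  IsEdge : Fin n × Fin n → Set
  IsEdge (u , v) = (u F.< v) × (adj G u v ≡ true)

  record EdgeSet : Set where
    constructor mkEdgeSet
    field
      edges  : List (Fin n × Fin n)
      valid  : All IsEdge edges
      unique : Unique edges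
  open EdgeSet public

  FixesEdge : Automorphism → Fin n × Fin n → Set
  FixesEdge φ (u , v) = (fun φ u ≡ u × fun φ v ≡ v) ⊎ (fun φ u ≡ v × fun φ v ≡ u)

  IsEdgeDetermining : EdgeSet → Set
  IsEdgeDetermining T =
    (φ : Automorphism) → All (FixesEdge φ) (edges T) → IsIdentity φ

  IsDet' : ℕ → Set
  IsDet' d = (Σ EdgeSet λ T → IsEdgeDetermining T × length (edges T) ≡ d)
           × (∀ T → IsEdgeDetermining T → d ≤ length (edges T))

-- An automorphism fixing both endpoints of an edge fixes that edge, so the
-- endpoints of an edge determining set T form a vertex determining set with
-- at most 2|T| vertices.
module Submission where

open import Defs
open import Data.Nat using (ℕ; _≤_; _+_; _*_; suc; z≤n; s≤s)
open import Data.Nat.Properties using (≤-reflexive; +-suc; *-suc; +-monoʳ-≤; m≤n⇒m≤1+n; module ≤-Reasoning)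
open import Data.Fin using (Fin)
open import Data.Fin.Subset using (Subset; _∈_; ∣_∣; _∪_; ⁅_⁆; ⊥; inside; outside)
open import Data.Fin.Subset.Properties using (p⊆p∪q; q⊆p∪q; x∈⁅x⁆; ∣⁅x⁆∣≡1; ∣⊥∣≡0)
open import Data.Vec using (_∷_; [])
open import Data.List using (List; length; []; _∷_)
open import Data.List.Relation.Unary.All using (All; []; _∷_)
open import Data.Product using (_×_; _,_)
open import Data.Sum using (inj₁)
open import Relation.Binary.PropositionalEquality using (_≡_; cong; subst)

∣p∪q∣≤∣p∣+∣q∣ : ∀ {n} (p q : Subset n) → ∣ p ∪ q ∣ ≤ ∣ p ∣ + ∣ q ∣
∣p∪q∣≤∣p∣+∣q∣ []            []            = z≤n
∣p∪q∣≤∣p∣+∣q∣ (outside ∷ p) (outside ∷ q) = ∣p∪q∣≤∣p∣+∣q∣ p q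
∣p∪q∣≤∣p∣+∣q∣ (inside  ∷ p) (outside ∷ q) = s≤s (∣p∪q∣≤∣p∣+∣q∣ p q)
∣p∪q∣≤∣p∣+∣q∣ (outside ∷ p) (inside  ∷ q) rewrite +-suc ∣ p ∣ ∣ q ∣ =
  s≤s (∣p∪q∣≤∣p∣+∣q∣ p q)
∣p∪q∣≤∣p∣+∣q∣ (inside  ∷ p) (inside  ∷ q) rewrite +-suc ∣ p ∣ ∣ q ∣ =
  s≤s (m≤n⇒m≤1+n (∣p∪q∣≤∣p∣+∣q∣ p q))

∣⁅x⁆∪p∣≤1+∣p∣ : ∀ {n} (x : Fin n) (p : Subset n) → ∣ ⁅ x ⁆ ∪ p ∣ ≤ suc ∣ p ∣
∣⁅x⁆∪p∣≤1+∣p∣ x p =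
  subst (λ k → ∣ ⁅ x ⁆ ∪ p ∣ ≤ k + ∣ p ∣) (∣⁅x⁆∣≡1 x) (∣p∪q∣≤∣p∣+∣q∣ ⁅ x ⁆ p)

endpoints : ∀ {n} → List (Fin n × Fin n) → Subset n
endpoints []             = ⊥
endpoints ((u , v) ∷ es) = ⁅ u ⁆ ∪ (⁅ v ⁆ ∪ endpoints es)

∣endpoints∣≤2*length : ∀ {n} (es : List (Fin n × Fin n)) →
  ∣ endpoints es ∣ ≤ 2 * length es
∣endpoints∣≤2*length {n} []         = ≤-reflexive (∣⊥∣≡0 n)
∣endpoints∣≤2*length ((u , v) ∷ es) = begin
  ∣ ⁅ u ⁆ ∪ (⁅ v ⁆ ∪ endpoints es) ∣ ≤⟨ ∣⁅x⁆∪p∣≤1+∣p∣ u _ ⟩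
  suc ∣ ⁅ v ⁆ ∪ endpoints es ∣       ≤⟨ s≤s (∣⁅x⁆∪p∣≤1+∣p∣ v _) ⟩
  2 + ∣ endpoints es ∣               ≤⟨ +-monoʳ-≤ 2 (∣endpoints∣≤2*length es) ⟩
  2 + 2 * length es                  ≡⟨ *-suc 2 (length es) ⟨
  2 * suc (length es)                ∎
  where open ≤-Reasoning

module _ {n : ℕ} (G : Graph n) where

  fixes-endpoints⇒fixes-edges : (φ : Automorphism G) (es : List (Fin n × Fin n)) →
    (∀ w → w ∈ endpoints es → fun φ w ≡ w) → All (FixesEdge G φ) es
  fixes-endpoints⇒fixes-edges φ []             fixed = []
  fixes-endpoints⇒fixes-edges φ ((u , v) ∷ es) fixed =
    inj₁ (fixed u (p⊆p∪q _ (x∈⁅x⁆ u)) , fixed v (inRest (p⊆p∪q _ (x∈⁅x⁆ v))))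
    ∷ fixes-endpoints⇒fixes-edges φ es (λ w w∈es → fixed w (inRest (q⊆p∪q ⁅ v ⁆ _ w∈es)))
    where
    inRest : ∀ {w} → w ∈ ⁅ v ⁆ ∪ endpoints es → w ∈ endpoints ((u , v) ∷ es)
    inRest = q⊆p∪q ⁅ u ⁆ _

  endpoints-determining : (T : EdgeSet G) → IsEdgeDetermining G T →
    IsVertexDetermining G (endpoints (edges T))
  endpoints-determining T T-determining φ fixed =
    T-determining φ (fixes-endpoints⇒fixes-edges φ (edges T) fixed)

-- The order and connectivity hypotheses only make det' meaningful in the paper;
-- the inequality holds without them.
theorem5 : (n : ℕ) → 3 ≤ n → (G : Graph n) → Connected G →
    (d d' : ℕ) → IsDet G d → IsDet' G d' → d ≤ 2 * d'
theorem5 n _ G _ d d' (_ , det-minimal) ((T , T-determining , ∣T∣≡d') , _) = begin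
  d                           ≤⟨ det-minimal _ (endpoints-determining G T T-determining) ⟩
  ∣ endpoints (edges T) ∣     ≤⟨ ∣endpoints∣≤2*length (edges T) ⟩
  2 * length (edges T)        ≡⟨ cong (2 *_) ∣T∣≡d' ⟩
  2 * d'                      ∎
  where open ≤-Reasoning
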